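{- Let $G$ be a singular simple graph whose set of core vertices is independent. Let $u$ and $w$ be core-forbidden vertices of $G$ with $u\not\sim w$, and let $G'=G+\{u,w\}$ be obtained by adding the edge $\{u,w\}$. If $\eta(G')=\eta(G)$, then $\ker\mathbf{A}(G')=\ker\mathbf{A}(G)$ and $G'$ has the same core-labelling as $G$, i.e. the same set $CV$ of core vertices, the same set $N(CV)$, and the same set $CFV_R$.
   Context: $\eta(G)=\dim\ker\mathbf{A}(G)$ for the $\{0,1\}$-adjacency matrix $\mathbf{A}(G)$; $G$ is singular if $\eta(G)>0$. A vertex $v$ is a core vertex if some $\mathbf{x}\in\ker\mathbf{A}$ has $x_v\neq0$ and core-forbidden otherwise; $CV$ is the set of core vertices, $N(CV)$ the set of vertices adjacent to some core vertex, and $CFV_R=V\setminus(CV\cup N(CV))$.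
   Formalization: The kernels of $\mathbf{A}(G)$ and $\mathbf{A}(G')$ are taken over ℚ, so the nullity η, the core vertices, N(CV) and CFV_R are determined by rational kernel vectors. -}

module Defs where

open import Data.Nat using (ℕ; zero; suc)
open import Data.Fin using (Fin; zero; suc; _≟_)
open import Data.Bool using (Bool; true; false; _∨_; _∧_; if_then_else_)
open import Data.Bool.Properties using (∨-comm; ∧-comm)
open import Data.Rational using (ℚ; 0ℚ; 1ℚ; _+_; _*_)
open import Data.Product using (Σ; ∃; _×_; _,_)
open import Relation.Nullary using (¬_; yes; no)
open import Relation.Nullary.Decidable using (⌊_⌋)
open import Relation.Binary.PropositionalEquality
open import Data.Empty using (⊥-elim)
open import Function.Bundles using (_⇔_)

record SimpleGraph (n : ℕ) : Set where
  field
    adj    : Fin n → Fin n → Bool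
    adj-sym : ∀ x y → adj x y ≡ adj y x
    adj-irrefl : ∀ x → adj x x ≡ false
open SimpleGraph public

_∼[_]_ : ∀ {n} → Fin n → SimpleGraph n → Fin n → Set
x ∼[ G ] y = adj G x y ≡ true

isPair : ∀ {n} → Fin n → Fin n → Fin n → Fin n → Bool
isPair u w x y = (⌊ x ≟ u ⌋ ∧ ⌊ y ≟ w ⌋) ∨ (⌊ x ≟ w ⌋ ∧ ⌊ y ≟ u ⌋)

addEdge : ∀ {n} (G : SimpleGraph n) (u w : Fin n) → ¬ (u ≡ w) → SimpleGraph n
addEdge {n} G u w u≢w = record { adj = a ; adj-sym = s ; adj-irrefl = i }
  where
  a : Fin n → Fin n → Bool
  a x y = adj G x y ∨ isPair u w x y
  s : ∀ x y → a x y ≡ a y x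
  s x y rewrite SimpleGraph.adj-sym G x y
              | ∧-comm ⌊ x ≟ u ⌋ ⌊ y ≟ w ⌋
              | ∧-comm ⌊ x ≟ w ⌋ ⌊ y ≟ u ⌋
              | ∨-comm (⌊ y ≟ w ⌋ ∧ ⌊ x ≟ u ⌋) (⌊ y ≟ u ⌋ ∧ ⌊ x ≟ w ⌋) = refl
  i : ∀ x → a x x ≡ false
  i x rewrite SimpleGraph.adj-irrefl G x with x ≟ u | x ≟ w
  ... | yes p | yes q = ⊥-elim (u≢w (trans (sym p) q))
  ... | yes p | no q = refl
  ... | no p | yes q = refl
  ... | no p | no q = refl

∑ : ∀ {n} → (Fin n → ℚ) → ℚ
∑ {zero} f = 0ℚ
∑ {suc n} f = f zero + ∑ (λ i → f (suc i))

Vec : ℕ → Set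
Vec n = Fin n → ℚ

A : ∀ {n} → SimpleGraph n → Fin n → Fin n → ℚ
A G x y = if adj G x y then 1ℚ else 0ℚ

InKer : ∀ {n} → SimpleGraph n → Vec n → Set
InKer G x = ∀ v → ∑ (λ y → A G v y * x y) ≡ 0ℚ

LinIndep : ∀ {n k} → (Fin k → Vec n) → Set
LinIndep {n} {k} xs =
  (c : Fin k → ℚ) → (∀ v → ∑ (λ i → c i * xs i v) ≡ 0ℚ) → ∀ i → c i ≡ 0ℚ

-- ker A(G) contains k linearly independent vectors (i.e. η(G) ≥ k)
HasIndepKer : ∀ {n} → SimpleGraph n → ℕ → Set
HasIndepKer {n} G k =
  Σ (Fin k → Vec n) λ xs → (∀ i → InKer G (xs i)) × LinIndep xs

-- η(G) = η(H): for every k, η(G) ≥ k iff η(H) ≥ k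
SameNullity : ∀ {n} → SimpleGraph n → SimpleGraph n → Set
SameNullity G H = ∀ k → HasIndepKer G k ⇔ HasIndepKer H k

Singular : ∀ {n} → SimpleGraph n → Set
Singular {n} G = Σ (Vec n) λ x → InKer G x × ∃ λ v → ¬ (x v ≡ 0ℚ)

Core : ∀ {n} → SimpleGraph n → Fin n → Set
Core {n} G v = Σ (Vec n) λ x → InKer G x × ¬ (x v ≡ 0ℚ)

CoreForbidden : ∀ {n} → SimpleGraph n → Fin n → Set
CoreForbidden G v = ¬ Core G v

InNCV : ∀ {n} → SimpleGraph n → Fin n → Set
InNCV G v = ∃ λ c → Core G c × v ∼[ G ] c

InCFVR : ∀ {n} → SimpleGraph n → Fin n → Set
InCFVR G v = ¬ Core G v × ¬ InNCV G v

CoreIndependent : ∀ {n} → SimpleGraph n → Set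
CoreIndependent G = ∀ a b → Core G a → Core G b → adj G a b ≡ false

module Submission where

-- Kernel vectors of G vanish at the core-forbidden vertices u and w, so the new edge
-- does not change A(G)x for x ∈ ker A(G), i.e. ker A(G) ⊆ ker A(G′). A vector of
-- ker A(G′) outside ker A(G) would extend every independent family in ker A(G) by one,
-- making η(G) unbounded, whereas ℚⁿ holds at most n independent vectors (Gaussian
-- elimination). Hence the kernels coincide, so do the core vertices, and since the new
-- edge avoids the core vertices, so do N(CV) and CFV_R.

open import Defs
open import Data.Nat using (ℕ; zero; suc; _≤_; z≤n; s≤s)
open import Data.Nat.Properties using (m≤n⇒m≤1+n; 1+n≰n)
open import Data.Fin using (Fin; zero; suc; punchIn; _≟_)
open import Data.Fin.Properties using (any?)
open import Data.Bool using (false; _∨_; if_then_else_)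
open import Data.Bool.Properties using (∨-identityʳ; ∧-zeroʳ)
open import Data.Rational using (ℚ; 0ℚ; 1ℚ; _+_; _*_; -_; _-_; 1/_; ≢-nonZero)
import Data.Rational.Properties as ℚ
open import Data.Rational.Solver using (module +-*-Solver)
open import Data.Vec.Functional using (_∷_; tail; insertAt; removeAt)
open import Data.Vec.Functional.Properties using (insertAt-lookup; insertAt-punchIn)
open import Data.Product using (_×_; _,_; proj₁; proj₂)
open import Algebra.Bundles using (CommutativeRing)
import Algebra.Properties.Semiring.Sum as SemiringSum
open import Relation.Nullary using (¬_; ¬?; Dec; yes; no; contradiction)
open import Relation.Nullary.Decidable using (⌊_⌋; decidable-stable)
open import Relation.Binary.PropositionalEquality
open import Function using (_∘_; flip)
open import Function.Bundles using (_⇔_; mk⇔; Equivalence)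
open import Function.Related.TypeIsomorphisms using (¬-cong-⇔)
open import Data.Product.Function.NonDependent.Propositional using (_×-⇔_)

open +-*-Solver
open Equivalence using (to; from)

module Sum = SemiringSum (CommutativeRing.semiring ℚ.+-*-commutativeRing)

∑≡sum : ∀ {n} (f : Fin n → ℚ) → ∑ f ≡ Sum.sum f
∑≡sum {zero}  f = refl
∑≡sum {suc n} f = cong (f zero +_) (∑≡sum (f ∘ suc))

∑-cong : ∀ {n} {f g : Fin n → ℚ} → f ≗ g → ∑ f ≡ ∑ g
∑-cong {f = f} {g} f≗g =
  trans (∑≡sum f) (trans (Sum.sum-cong-≗ {x = f} {y = g} f≗g) (sym (∑≡sum g)))

∑-zero : ∀ {n} {f : Fin n → ℚ} → (∀ i → f i ≡ 0ℚ) → ∑ f ≡ 0ℚ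
∑-zero {n} f≗0 = trans (∑-cong f≗0) (trans (∑≡sum {n} (λ _ → 0ℚ)) (Sum.sum-replicate-zero n))

∑-distrib-+ : ∀ {n} (f g : Fin n → ℚ) → ∑ (λ i → f i + g i) ≡ ∑ f + ∑ g
∑-distrib-+ f g = trans (∑≡sum (λ i → f i + g i)) (trans (Sum.∑-distrib-+ f g)
  (sym (cong₂ _+_ (∑≡sum f) (∑≡sum g))))

*-distribˡ-∑ : ∀ {n} (c : ℚ) (f : Fin n → ℚ) → c * ∑ f ≡ ∑ (λ i → c * f i)
*-distribˡ-∑ c f = trans (cong (c *_) (∑≡sum f)) (trans (Sum.*-distribˡ-sum c f)
  (sym (∑≡sum (λ i → c * f i))))

∑-comm : ∀ {m n} (f : Fin m → Fin n → ℚ) →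
         ∑ (λ i → ∑ (λ j → f i j)) ≡ ∑ (λ j → ∑ (λ i → f i j))
∑-comm f = trans (nested f) (trans (Sum.∑-comm f) (sym (nested (flip f))))
  where
  nested : ∀ {a b} (g : Fin a → Fin b → ℚ) → ∑ (λ i → ∑ (g i)) ≡ Sum.sum (λ i → Sum.sum (g i))
  nested g = trans (∑≡sum (λ i → ∑ (g i))) (Sum.sum-cong-≗ {x = λ i → ∑ (g i)} (∑≡sum ∘ g))

∑-removeAt : ∀ {n} (f : Fin (suc n) → ℚ) j → ∑ f ≡ f j + ∑ (removeAt f j)
∑-removeAt f j = trans (∑≡sum f) (trans (Sum.sum-remove f)
  (cong (f j +_) (sym (∑≡sum (removeAt f j)))))

p*q≡0⇒q≡0 : ∀ p q → p ≢ 0ℚ → p * q ≡ 0ℚ → q ≡ 0ℚ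
p*q≡0⇒q≡0 p q p≢0 pq≡0 = begin
  q              ≡⟨ sym (ℚ.*-identityˡ q) ⟩
  1ℚ * q         ≡⟨ cong (_* q) (sym (ℚ.*-inverseˡ p)) ⟩
  1/ p * p * q   ≡⟨ ℚ.*-assoc (1/ p) p q ⟩
  1/ p * (p * q) ≡⟨ cong (1/ p *_) pq≡0 ⟩
  1/ p * 0ℚ      ≡⟨ ℚ.*-zeroʳ (1/ p) ⟩
  0ℚ             ∎
  where
  open ≡-Reasoning
  instance _ = ≢-nonZero p≢0

q≡0⇒p*q≡0 : ∀ p {q} → q ≡ 0ℚ → p * q ≡ 0ℚ
q≡0⇒p*q≡0 p refl = ℚ.*-zeroʳ p

Matrix : ℕ → ℕ → Set
Matrix m n = Fin m → Fin n → ℚ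

_·_ : ∀ {m n} → Matrix m n → Vec n → Fin m → ℚ
(M · x) v = ∑ (λ y → M v y * x y)

InKernel : ∀ {m n} → Matrix m n → Vec n → Set
InKernel M x = ∀ v → (M · x) v ≡ 0ℚ

lincomb : ∀ {k n} → (Fin k → ℚ) → (Fin k → Vec n) → Vec n
lincomb c xs v = ∑ (λ i → c i * xs i v)

·-lincomb : ∀ {m n k} (M : Matrix m n) (c : Fin k → ℚ) (xs : Fin k → Vec n) v →
            (M · lincomb c xs) v ≡ lincomb c (λ i → M · xs i) v
·-lincomb M c xs v = begin
  ∑ (λ y → M v y * ∑ (λ i → c i * xs i y))
    ≡⟨ ∑-cong (λ y → *-distribˡ-∑ (M v y) (λ i → c i * xs i y)) ⟩
  ∑ (λ y → ∑ (λ i → M v y * (c i * xs i y)))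
    ≡⟨ ∑-comm (λ y i → M v y * (c i * xs i y)) ⟩
  ∑ (λ i → ∑ (λ y → M v y * (c i * xs i y)))
    ≡⟨ ∑-cong (λ i → ∑-cong (λ y → swap (M v y) (c i) (xs i y))) ⟩
  ∑ (λ i → ∑ (λ y → c i * (M v y * xs i y)))
    ≡⟨ ∑-cong (λ i → sym (*-distribˡ-∑ (c i) (λ y → M v y * xs i y))) ⟩
  ∑ (λ i → c i * ∑ (λ y → M v y * xs i y)) ∎
  where
  open ≡-Reasoning
  swap : ∀ a b c → a * (b * c) ≡ b * (a * c)
  swap = solve 3 (λ a b c → a :* (b :* c) := b :* (a :* c)) refl

lincomb-*ˡ : ∀ {k n} p (d : Fin k → ℚ) (xs : Fin k → Vec n) v →
             lincomb (λ i → p * d i) xs v ≡ p * lincomb d xs v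
lincomb-*ˡ p d xs v = trans (∑-cong (λ i → ℚ.*-assoc p (d i) (xs i v)))
                            (sym (*-distribˡ-∑ p (λ i → d i * xs i v)))

lincomb-insertAt : ∀ {k n} (c : Fin k → ℚ) j a (xs : Fin (suc k) → Vec n) v →
                   lincomb (insertAt c j a) xs v ≡ a * xs j v + lincomb c (removeAt xs j) v
lincomb-insertAt c j a xs v = trans (∑-removeAt (λ i → insertAt c j a i * xs i v) j) (cong₂ _+_
  (cong (_* xs j v) (insertAt-lookup c j a))
  (∑-cong (λ i → cong (_* xs (punchIn j i) v) (insertAt-punchIn c j a i))))

LinIndep-tail : ∀ {k n} (xs : Fin k → Vec (suc n)) → (∀ i → xs i zero ≡ 0ℚ) →
                LinIndep xs → LinIndep (tail ∘ xs)
LinIndep-tail xs head≡0 indep c comb≡0 = indep c λ where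
  zero    → ∑-zero (λ i → q≡0⇒p*q≡0 (c i) (head≡0 i))
  (suc v) → comb≡0 v

eliminate : ∀ {k n} → (Fin (suc k) → Vec (suc n)) → Fin (suc k) → Fin k → Vec n
eliminate xs j i v = xs j zero * xs (punchIn j i) (suc v) - xs (punchIn j i) zero * xs j (suc v)

lincomb-eliminate : ∀ {k n} (d : Fin k → ℚ) (xs : Fin (suc k) → Vec (suc n)) j v →
  lincomb d (eliminate xs j) v ≡
  xs j zero * lincomb d (removeAt xs j) (suc v) - lincomb d (removeAt xs j) zero * xs j (suc v)
lincomb-eliminate d xs j v = begin
  ∑ (λ i → d i * (p * zs i (suc v) - zs i zero * q))
    ≡⟨ ∑-cong (λ i → regroup (d i) (zs i (suc v)) (zs i zero) p q) ⟩
  ∑ (λ i → p * (d i * zs i (suc v)) + - q * (d i * zs i zero))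
    ≡⟨ ∑-distrib-+ (λ i → p * (d i * zs i (suc v))) (λ i → - q * (d i * zs i zero)) ⟩
  ∑ (λ i → p * (d i * zs i (suc v))) + ∑ (λ i → - q * (d i * zs i zero))
    ≡⟨ sym (cong₂ _+_ (*-distribˡ-∑ p (λ i → d i * zs i (suc v)))
                      (*-distribˡ-∑ (- q) (λ i → d i * zs i zero))) ⟩
  p * lincomb d zs (suc v) + - q * lincomb d zs zero
    ≡⟨ solve 4 (λ p q L₁ L₀ → p :* L₁ :+ :- q :* L₀ := p :* L₁ :- L₀ :* q) refl p q _ _ ⟩
  p * lincomb d zs (suc v) - lincomb d zs zero * q ∎
  where
  open ≡-Reasoning
  p = xs j zero
  q = xs j (suc v)
  zs = removeAt xs j
  regroup : ∀ δ a b p q → δ * (p * a - b * q) ≡ p * (δ * a) + - q * (δ * b)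
  regroup = solve 5 (λ δ a b p q → δ :* (p :* a :- b :* q)
                                := p :* (δ :* a) :+ :- q :* (δ :* b)) refl

LinIndep-eliminate : ∀ {k n} (xs : Fin (suc k) → Vec (suc n)) j → xs j zero ≢ 0ℚ →
                     LinIndep xs → LinIndep (eliminate xs j)
LinIndep-eliminate xs j p≢0 indep d comb≡0 i =
  p*q≡0⇒q≡0 p (d i) p≢0
    (trans (sym (insertAt-punchIn (λ i → p * d i) j (- S) i)) (indep c c-comb≡0 (punchIn j i)))
  where
  p = xs j zero
  zs = removeAt xs j
  S = lincomb d zs zero
  -- Inserting −S at the pivot cancels the head coordinate of p·d against row j.
  c = insertAt (λ i → p * d i) j (- S)
  c-comb : ∀ v → lincomb c xs v ≡ - S * xs j v + p * lincomb d zs v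
  c-comb v = trans (lincomb-insertAt _ j (- S) xs v)
                   (cong (- S * xs j v +_) (lincomb-*ˡ p d zs v))
  c-comb≡0 : ∀ v → lincomb c xs v ≡ 0ℚ
  c-comb≡0 zero = trans (c-comb zero)
    (solve 2 (λ S p → :- S :* p :+ p :* S := con 0ℚ) refl S p)
  c-comb≡0 (suc v) = begin
    lincomb c xs (suc v)                          ≡⟨ c-comb (suc v) ⟩
    - S * xs j (suc v) + p * lincomb d zs (suc v) ≡⟨ swap S (xs j (suc v)) p _ ⟩
    p * lincomb d zs (suc v) - S * xs j (suc v)   ≡⟨ sym (lincomb-eliminate d xs j v) ⟩
    lincomb d (eliminate xs j) v                  ≡⟨ comb≡0 v ⟩
    0ℚ                                            ∎
    where
    open ≡-Reasoning
    swap : ∀ S q p L → - S * q + p * L ≡ p * L - S * q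
    swap = solve 4 (λ S q p L → :- S :* q :+ p :* L := p :* L :- S :* q) refl

LinIndep⇒≤ : ∀ {k n} (xs : Fin k → Vec n) → LinIndep xs → k ≤ n
LinIndep⇒≤ {zero}          _  _     = z≤n
LinIndep⇒≤ {suc k} {zero}  _  indep = contradiction (indep (λ _ → 1ℚ) (λ ()) zero) ℚ.1≢0
LinIndep⇒≤ {suc k} {suc n} xs indep with any? (λ i → ¬? (xs i zero ℚ.≟ 0ℚ))
... | yes (j , pivot≢0) = s≤s (LinIndep⇒≤ (eliminate xs j) (LinIndep-eliminate xs j pivot≢0 indep))
... | no  noPivot       = m≤n⇒m≤1+n (LinIndep⇒≤ (tail ∘ xs) (LinIndep-tail xs head≡0 indep))
  where
  head≡0 : ∀ i → xs i zero ≡ 0ℚ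
  head≡0 i = decidable-stable (xs i zero ℚ.≟ 0ℚ) (λ ≢0 → noPivot (i , ≢0))

LinIndep-∷ : ∀ {m n k} (M : Matrix m n) {x : Vec n} {xs : Fin k → Vec n} v →
             (M · x) v ≢ 0ℚ → (∀ i → InKernel M (xs i)) → LinIndep xs → LinIndep (x ∷ xs)
LinIndep-∷ M {x} {xs} v Mx≢0 xs∈ker indep c comb≡0 = λ where
    zero    → c₀≡0
    (suc i) → indep (tail c) tail-comb≡0 i
  where
  open ≡-Reasoning
  c₀Mx≡0 : c zero * (M · x) v ≡ 0ℚ
  c₀Mx≡0 = begin
    c zero * (M · x) v                  ≡⟨ sym (ℚ.+-identityʳ _) ⟩
    c zero * (M · x) v + 0ℚ             ≡⟨ cong (c zero * (M · x) v +_) (sym (∑-zero Mxs≡0)) ⟩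
    lincomb c (λ i → M · (x ∷ xs) i) v ≡⟨ sym (·-lincomb M c (x ∷ xs) v) ⟩
    (M · lincomb c (x ∷ xs)) v         ≡⟨ ∑-zero (λ y → q≡0⇒p*q≡0 (M v y) (comb≡0 y)) ⟩
    0ℚ                                  ∎
    where
    Mxs≡0 : ∀ i → c (suc i) * (M · xs i) v ≡ 0ℚ
    Mxs≡0 i = q≡0⇒p*q≡0 (c (suc i)) (xs∈ker i v)
  c₀≡0 : c zero ≡ 0ℚ
  c₀≡0 = p*q≡0⇒q≡0 ((M · x) v) (c zero) Mx≢0 (trans (ℚ.*-comm ((M · x) v) (c zero)) c₀Mx≡0)
  tail-comb≡0 : ∀ y → lincomb (tail c) xs y ≡ 0ℚ
  tail-comb≡0 y = begin
    lincomb (tail c) xs y                ≡⟨ sym (ℚ.+-identityˡ _) ⟩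
    0ℚ + lincomb (tail c) xs y           ≡⟨ cong (_+ lincomb (tail c) xs y) (sym c₀x≡0) ⟩
    c zero * x y + lincomb (tail c) xs y ≡⟨ comb≡0 y ⟩
    0ℚ                                   ∎
    where
    c₀x≡0 : c zero * x y ≡ 0ℚ
    c₀x≡0 = trans (cong (_* x y) c₀≡0) (ℚ.*-zeroˡ (x y))

InKer-⊆⇒⊇ : ∀ {n} (G H : SimpleGraph n) → (∀ x → InKer G x → InKer H x) →
            SameNullity G H → ∀ x → InKer H x → InKer G x
InKer-⊆⇒⊇ {n} G H G⊆H same x x∈kerH v with (A G · x) v ℚ.≟ 0ℚ
... | yes Gx≡0 = Gx≡0
... | no  Gx≢0 = contradiction (LinIndep⇒≤ xs indep) 1+n≰n
  where
  -- x lies outside ker G, so it extends any independent family of ker G inside ker H.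
  extend : ∀ {k} → HasIndepKer G k → HasIndepKer G (suc k)
  extend {k} (xs , xs∈ker , xs-indep) = from (same (suc k))
    ( x ∷ xs
    , (λ where zero → x∈kerH ; (suc i) → G⊆H (xs i) (xs∈ker i))
    , LinIndep-∷ (A G) v Gx≢0 xs∈ker xs-indep )
  indepKer : ∀ k → HasIndepKer G k
  indepKer zero    = (λ ()) , (λ ()) , (λ _ _ ())
  indepKer (suc k) = extend (indepKer k)
  xs = proj₁ (indepKer (suc n))
  indep : LinIndep xs
  indep = proj₂ (proj₂ (indepKer (suc n)))

InKer-coreForbidden : ∀ {n} (G : SimpleGraph n) {x z} → InKer G x → CoreForbidden G z → x z ≡ 0ℚ
InKer-coreForbidden G {x} {z} x∈ker z-cf =
  decidable-stable (x z ℚ.≟ 0ℚ) (λ xz≢0 → z-cf (x , x∈ker , xz≢0))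

module _ {n} (G : SimpleGraph n) {u w : Fin n} (u≢w : u ≢ w) where

  private
    G′ = addEdge G u w u≢w

  adj-addEdge : ∀ v y → y ≢ u → y ≢ w → adj G′ v y ≡ adj G v y
  adj-addEdge v y y≢u y≢w with y ≟ u | y ≟ w
  ... | yes y≡u | _        = contradiction y≡u y≢u
  ... | no _    | yes y≡w  = contradiction y≡w y≢w
  ... | no _    | no _     = trans
    (cong (adj G v y ∨_) (cong₂ _∨_ (∧-zeroʳ ⌊ v ≟ u ⌋) (∧-zeroʳ ⌊ v ≟ w ⌋)))
    (∨-identityʳ (adj G v y))

  ·-addEdge : ∀ {x} → x u ≡ 0ℚ → x w ≡ 0ℚ → ∀ v → (A G′ · x) v ≡ (A G · x) v
  ·-addEdge {x} xu≡0 xw≡0 v = ∑-cong term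
    where
    term : ∀ y → A G′ v y * x y ≡ A G v y * x y
    term y = byCases (y ≟ u) (y ≟ w)
      where
      vanishing : x y ≡ 0ℚ → A G′ v y * x y ≡ A G v y * x y
      vanishing xy≡0 = trans (q≡0⇒p*q≡0 (A G′ v y) xy≡0) (sym (q≡0⇒p*q≡0 (A G v y) xy≡0))
      byCases : Dec (y ≡ u) → Dec (y ≡ w) → A G′ v y * x y ≡ A G v y * x y
      byCases (yes y≡u) _         = vanishing (trans (cong x y≡u) xu≡0)
      byCases (no _)    (yes y≡w) = vanishing (trans (cong x y≡w) xw≡0)
      byCases (no y≢u)  (no y≢w)  =
        cong (λ b → (if b then 1ℚ else 0ℚ) * x y) (adj-addEdge v y y≢u y≢w)

  InKer-addEdge : CoreForbidden G u → CoreForbidden G w → ∀ x → InKer G x → InKer G′ x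
  InKer-addEdge u-cf w-cf x x∈ker v = trans
    (·-addEdge (InKer-coreForbidden G x∈ker u-cf) (InKer-coreForbidden G x∈ker w-cf) v) (x∈ker v)

module _ {n} (G H : SimpleGraph n) where

  Core-cong : (∀ x → InKer G x ⇔ InKer H x) → ∀ v → Core G v ⇔ Core H v
  Core-cong ker v = mk⇔ (λ (x , x∈ker , xv≢0) → x , to   (ker x) x∈ker , xv≢0)
                        (λ (x , x∈ker , xv≢0) → x , from (ker x) x∈ker , xv≢0)

  InNCV-cong : (∀ v → Core G v ⇔ Core H v) →
               (∀ v c → Core G c → adj G v c ≡ adj H v c) →
               ∀ v → InNCV G v ⇔ InNCV H v
  InNCV-cong core adj≡ v = mk⇔
    (λ (c , c-core , v∼c) → c , to (core c) c-core , trans (sym (adj≡ v c c-core)) v∼c)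
    (λ (c , c-core , v∼c) → let c-coreG = from (core c) c-core in
                             c , c-coreG , trans (adj≡ v c c-coreG) v∼c)

  InCFVR-cong : (∀ v → Core G v ⇔ Core H v) → (∀ v → InNCV G v ⇔ InNCV H v) →
                ∀ v → InCFVR G v ⇔ InCFVR H v
  InCFVR-cong core ncv v = ¬-cong-⇔ (core v) ×-⇔ ¬-cong-⇔ (ncv v)

mainTheorem19 : ∀ {n} (G : SimpleGraph n) (u w : Fin n) (u≢w : ¬ (u ≡ w)) →
    Singular G →
    CoreIndependent G →
    CoreForbidden G u →
    CoreForbidden G w →
    adj G u w ≡ false →
    SameNullity G (addEdge G u w u≢w) →
    (∀ x → InKer G x ⇔ InKer (addEdge G u w u≢w) x)
    × (∀ v → Core G v ⇔ Core (addEdge G u w u≢w) v)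
    × (∀ v → InNCV G v ⇔ InNCV (addEdge G u w u≢w) v)
    × (∀ v → InCFVR G v ⇔ InCFVR (addEdge G u w u≢w) v)
mainTheorem19 G u w u≢w _ _ u-cf w-cf _ same = ker , core , ncv , InCFVR-cong G G′ core ncv
  where
  G′ = addEdge G u w u≢w
  G⊆G′ : ∀ x → InKer G x → InKer G′ x
  G⊆G′ = InKer-addEdge G u≢w u-cf w-cf
  ker : ∀ x → InKer G x ⇔ InKer G′ x
  ker x = mk⇔ (G⊆G′ x) (InKer-⊆⇒⊇ G G′ G⊆G′ same x)
  core : ∀ v → Core G v ⇔ Core G′ v
  core = Core-cong G G′ ker
  ncv : ∀ v → InNCV G v ⇔ InNCV G′ v
  ncv = InNCV-cong G G′ core λ v c c-core →
    sym (adj-addEdge G u≢w v c (λ { refl → u-cf c-core }) (λ { refl → w-cf c-core }))
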